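{- Let $B$ be a finite non-decreasing sequence of real numbers, and let $A$ and $A'$ be subsequences of $B$ with $0<|A|=|A'|<|B|$. Then $A\leq A'$ if and only if $B\setminus A'\leq B\setminus A$.
   Context: A subsequence of $B$ is obtained by selecting the entries of $B$ at some set of positions (keeping their order); $B\setminus A$ denotes the subsequence of $B$ formed by the entries at the positions not selected for $A$. All these subsequences are non-decreasing. For two finite non-decreasing real sequences $X=(x_i)_{i=0}^{m-1}$ and $Y=(y_i)_{i=0}^{m-1}$ of the same length, $X\leq Y$ means $x_i\leq y_i$ for all $i=0,1,\ldots,m-1$. -}

module Defs where

open import Data.Bool using (Bool; true; false)
open import Data.Nat using (ℕ)
open import Data.Vec using (Vec; []; _∷_)
open import Data.List using (List; []; _∷_)

-- The subsequence of a sequence selected by a set of positions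
-- (a Subset n = Vec Bool n, true = selected), entries kept in order.
select : ∀ {a} {A : Set a} {n : ℕ} → Vec A n → Vec Bool n → List A
select []       []            = []
select (x ∷ xs) (true  ∷ s)  = x ∷ select xs s
select (x ∷ xs) (false ∷ s)  = select xs s

-- Let b be an entry of the sorted B at a position selected by both S and S'. Entries of B
-- before b are ≤ b and entries after it are ≥ b, so inserting b at its place into both
-- sides of an entrywise comparison does not change whether it holds: it only shifts the
-- pairing of the entries lying between the two insertion points, and these are all
-- squeezed to b. Cancelling all common positions, A ≤ A' iff B|(S ─ S') ≤ B|(S' ─ S).
-- As ∁ S' ─ ∁ S = S ─ S', the complements reduce to the same comparison.
module Submission where

open import Defs
open import Data.Nat using (ℕ; _<_)
open import Data.Bool using (true; false)
open import Data.Vec using (Vec; []; _∷_; toList)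
open import Data.Fin.Subset using (Subset; ∣_∣; ∁; _─_)
open import Data.List using (List; []; _∷_; _++_; _∷ʳ_)
open import Data.List.Properties using (∷ʳ-++)
open import Data.List.Relation.Unary.All as All using (All; []; _∷_)
open import Data.List.Relation.Unary.All.Properties using (++⁺)
open import Data.List.Relation.Unary.AllPairs using (AllPairs; _∷_)
open import Data.List.Relation.Unary.Linked.Properties using (Linked⇒AllPairs)
open import Data.List.Relation.Unary.Sorted.TotalOrder using (Sorted)
open import Data.List.Relation.Binary.Pointwise using (Pointwise; []; _∷_; tail)
open import Data.Empty using (⊥-elim)
open import Function.Bundles using (_⇔_; mk⇔; Equivalence)
open import Function.Construct.Symmetry using (⇔-sym)
open import Function.Construct.Composition using (_⇔-∘_)
open import Relation.Binary.Core using (Rel)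
open import Relation.Binary.Definitions using (Reflexive; Transitive)
open import Relation.Binary.Bundles using (TotalOrder)
open import Relation.Binary.PropositionalEquality using (_≡_; refl; cong; subst₂)
open import Relation.Nullary using (¬_)

open Equivalence using (to; from)

∁p─∁q≡q─p : ∀ {n} (p q : Subset n) → ∁ p ─ ∁ q ≡ q ─ p
∁p─∁q≡q─p []          []          = refl
∁p─∁q≡q─p (true  ∷ p) (true  ∷ q) = cong (false ∷_) (∁p─∁q≡q─p p q)
∁p─∁q≡q─p (true  ∷ p) (false ∷ q) = cong (false ∷_) (∁p─∁q≡q─p p q)
∁p─∁q≡q─p (false ∷ p) (true  ∷ q) = cong (true  ∷_) (∁p─∁q≡q─p p q)
∁p─∁q≡q─p (false ∷ p) (false ∷ q) = cong (false ∷_) (∁p─∁q≡q─p p q)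

All-select : ∀ {a ℓ} {A : Set a} {P : A → Set ℓ} {n} (xs : Vec A n) (s : Subset n) →
             All P (toList xs) → All P (select xs s)
All-select []       []          []         = []
All-select (x ∷ xs) (true  ∷ s) (px ∷ pxs) = px ∷ All-select xs s pxs
All-select (x ∷ xs) (false ∷ s) (_  ∷ pxs) = All-select xs s pxs

module _ {a ℓ} {A : Set a} {_≤_ : Rel A ℓ}
         (≤-refl : Reflexive _≤_) (≤-trans : Transitive _≤_) where

  infix 4 _≤*_ _≼_

  _≤*_ : List A → List A → Set _
  _≤*_ = Pointwise _≤_

  _≼_ : List A → List A → Set _
  xs ≼ ys = All (λ x → All (x ≤_) ys) xs

  ¬++∷≤*[] : ∀ xs {b ys} → ¬ (xs ++ b ∷ ys) ≤* []
  ¬++∷≤*[] []      ()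
  ¬++∷≤*[] (_ ∷ _) ()

  ¬[]≤*++∷ : ∀ xs {b ys} → ¬ [] ≤* (xs ++ b ∷ ys)
  ¬[]≤*++∷ []      ()
  ¬[]≤*++∷ (_ ∷ _) ()

  head-≤ : ∀ {b x xs} ys₁ {ys₂} → All (_≤ b) ys₁ → (x ∷ xs) ≤* (ys₁ ++ b ∷ ys₂) → x ≤ b
  head-≤ []       _          (x≤b ∷ _) = x≤b
  head-≤ (y ∷ ys) (y≤b ∷ _)  (x≤y ∷ _) = ≤-trans x≤y y≤b

  -- In ≤*-insertˡ and ≤*-insertʳ the entry c stands for b; it is kept general so that
  -- the induction can substitute the next entry for it.
  ≤*-insertˡ : ∀ {b c} xs₁ xs₂ ys → All (_≤ b) xs₁ → All (b ≤_) ys → b ≤ c →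
               (xs₁ ++ xs₂) ≤* ys ⇔ (xs₁ ++ b ∷ xs₂) ≤* (c ∷ ys)
  ≤*-insertˡ [] xs₂ ys _ _ b≤c = mk⇔ (b≤c ∷_) tail
  ≤*-insertˡ (x ∷ xs₁) xs₂ [] _ _ _ =
    mk⇔ (λ ()) (λ { (_ ∷ p) → ⊥-elim (¬++∷≤*[] xs₁ p) })
  ≤*-insertˡ (x ∷ xs₁) xs₂ (y ∷ ys) (x≤b ∷ xs₁≤b) (b≤y ∷ b≤ys) b≤c = mk⇔
    (λ { (_ ∷ p) → ≤-trans x≤b b≤c ∷ to   ih p })
    (λ { (_ ∷ p) → ≤-trans x≤b b≤y ∷ from ih p })
    where ih = ≤*-insertˡ xs₁ xs₂ ys xs₁≤b b≤ys b≤y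

  ≤*-insertʳ : ∀ {b c} xs ys₁ ys₂ → All (b ≤_) xs → All (_≤ b) ys₁ → c ≤ b → b ≤ c →
               xs ≤* (ys₁ ++ ys₂) ⇔ (c ∷ xs) ≤* (ys₁ ++ b ∷ ys₂)
  ≤*-insertʳ xs [] ys₂ _ _ c≤b _ = mk⇔ (c≤b ∷_) tail
  ≤*-insertʳ [] (y ∷ ys₁) ys₂ _ _ _ _ =
    mk⇔ (λ ()) (λ { (_ ∷ p) → ⊥-elim (¬[]≤*++∷ ys₁ p) })
  ≤*-insertʳ {b} (x ∷ xs) (y ∷ ys₁) ys₂ (b≤x ∷ b≤xs) (y≤b ∷ ys₁≤b) c≤b b≤c = mk⇔
    (λ { (x≤y ∷ p) → ≤-trans c≤b (≤-trans b≤x x≤y) ∷ to (ih (≤-trans x≤y y≤b)) p })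
    (λ { (c≤y ∷ p) → let x≤b = head-≤ ys₁ ys₁≤b p in
                     ≤-trans x≤b (≤-trans b≤c c≤y) ∷ from (ih x≤b) p })
    where
    ih : x ≤ b → xs ≤* (ys₁ ++ ys₂) ⇔ (x ∷ xs) ≤* (ys₁ ++ b ∷ ys₂)
    ih x≤b = ≤*-insertʳ xs ys₁ ys₂ b≤xs ys₁≤b x≤b b≤x

  ≤*-insert : ∀ {b} xs₁ xs₂ ys₁ ys₂ →
              All (_≤ b) xs₁ → All (b ≤_) xs₂ → All (_≤ b) ys₁ → All (b ≤_) ys₂ →
              (xs₁ ++ xs₂) ≤* (ys₁ ++ ys₂) ⇔ (xs₁ ++ b ∷ xs₂) ≤* (ys₁ ++ b ∷ ys₂)
  ≤*-insert []        xs₂ []        ys₂ _ _ _ _ = mk⇔ (≤-refl ∷_) tail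
  ≤*-insert []        xs₂ (y ∷ ys₁) ys₂ _ b≤xs₂ ys₁≤b _ =
    ≤*-insertʳ xs₂ (y ∷ ys₁) ys₂ b≤xs₂ ys₁≤b ≤-refl ≤-refl
  ≤*-insert (x ∷ xs₁) xs₂ []        ys₂ xs₁≤b _ _ b≤ys₂ =
    ≤*-insertˡ (x ∷ xs₁) xs₂ ys₂ xs₁≤b b≤ys₂ ≤-refl
  ≤*-insert (x ∷ xs₁) xs₂ (y ∷ ys₁) ys₂ (_ ∷ xs₁≤b) b≤xs₂ (_ ∷ ys₁≤b) b≤ys₂ = mk⇔
    (λ { (x≤y ∷ p) → x≤y ∷ to   ih p })
    (λ { (x≤y ∷ p) → x≤y ∷ from ih p })
    where ih = ≤*-insert xs₁ xs₂ ys₁ ys₂ xs₁≤b b≤xs₂ ys₁≤b b≤ys₂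

  -- us and vs collect the entries of B already passed that were selected by only one
  -- of the two subsets.
  ≤*-select⇔≤*-select-─ : ∀ {n} (xs : Vec A n) (s t : Subset n) us vs →
    AllPairs _≤_ (toList xs) → us ≼ toList xs → vs ≼ toList xs →
    (us ++ select xs s) ≤* (vs ++ select xs t) ⇔
    (us ++ select xs (s ─ t)) ≤* (vs ++ select xs (t ─ s))
  ≤*-select⇔≤*-select-─ [] [] [] us vs _ _ _ = mk⇔ (λ p → p) (λ p → p)
  ≤*-select⇔≤*-select-─ (x ∷ xs) (true ∷ s) (true ∷ t) us vs (x≤xs ∷ xs↑) us≼ vs≼ =
    ≤*-select⇔≤*-select-─ xs s t us vs xs↑ (All.map All.tail us≼) (All.map All.tail vs≼)
    ⇔-∘ ⇔-sym (≤*-insert us (select xs s) vs (select xs t)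
                 (All.map All.head us≼) (All-select xs s x≤xs)
                 (All.map All.head vs≼) (All-select xs t x≤xs))
  ≤*-select⇔≤*-select-─ (x ∷ xs) (true ∷ s) (false ∷ t) us vs (x≤xs ∷ xs↑) us≼ vs≼ =
    subst₂ (λ l l′ → l ≤* (vs ++ select xs t) ⇔ l′ ≤* (vs ++ select xs (t ─ s)))
           (∷ʳ-++ us x (select xs s)) (∷ʳ-++ us x (select xs (s ─ t)))
           (≤*-select⇔≤*-select-─ xs s t (us ∷ʳ x) vs xs↑
              (++⁺ (All.map All.tail us≼) (x≤xs ∷ [])) (All.map All.tail vs≼))
  ≤*-select⇔≤*-select-─ (x ∷ xs) (false ∷ s) (true ∷ t) us vs (x≤xs ∷ xs↑) us≼ vs≼ =
    subst₂ (λ r r′ → (us ++ select xs s) ≤* r ⇔ (us ++ select xs (s ─ t)) ≤* r′)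
           (∷ʳ-++ vs x (select xs t)) (∷ʳ-++ vs x (select xs (t ─ s)))
           (≤*-select⇔≤*-select-─ xs s t us (vs ∷ʳ x) xs↑
              (All.map All.tail us≼) (++⁺ (All.map All.tail vs≼) (x≤xs ∷ [])))
  ≤*-select⇔≤*-select-─ (x ∷ xs) (false ∷ s) (false ∷ t) us vs (_ ∷ xs↑) us≼ vs≼ =
    ≤*-select⇔≤*-select-─ xs s t us vs xs↑ (All.map All.tail us≼) (All.map All.tail vs≼)

  ≤*-select-∁⇔≤*-select-─ : ∀ {n} (xs : Vec A n) (s t : Subset n) →
    AllPairs _≤_ (toList xs) →
    select xs (∁ t) ≤* select xs (∁ s) ⇔ select xs (s ─ t) ≤* select xs (t ─ s)
  ≤*-select-∁⇔≤*-select-─ xs s t xs↑ =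
    subst₂ (λ u v → select xs (∁ t) ≤* select xs (∁ s) ⇔ select xs u ≤* select xs v)
           (∁p─∁q≡q─p t s) (∁p─∁q≡q─p s t)
           (≤*-select⇔≤*-select-─ xs (∁ t) (∁ s) [] [] xs↑ [] [])

lemma2p5 : ∀ {c ℓ₁ ℓ₂} (O : TotalOrder c ℓ₁ ℓ₂) {n : ℕ}
           (B : Vec (TotalOrder.Carrier O) n) (S S' : Subset n) →
           Sorted O (toList B) →
           0 < ∣ S ∣ → ∣ S ∣ ≡ ∣ S' ∣ → ∣ S' ∣ < n →
           Pointwise (TotalOrder._≤_ O) (select B S) (select B S')
             ⇔ Pointwise (TotalOrder._≤_ O) (select B (∁ S')) (select B (∁ S))
lemma2p5 O B S S' B-sorted _ _ _ =
  ⇔-sym (≤*-select-∁⇔≤*-select-─ ≤-refl ≤-trans B S S' B↑)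
  ⇔-∘ ≤*-select⇔≤*-select-─ ≤-refl ≤-trans B S S' [] [] B↑ [] []
  where
  open TotalOrder O using () renaming (refl to ≤-refl; trans to ≤-trans)
  B↑ = Linked⇒AllPairs ≤-trans B-sorted
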